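{- Let $k\geq 2$ be an integer and let $D$ be a digraph with three pairwise disjoint subsets $X,Y,W$ of $V(D)$ with $|X|=|Y|=k$. Suppose that $U$ is a nearly in-dominating set of $D\setminus(X\cup Y)$ with $|U|=3k$, and that $\mathcal{Q}$ is a collection of $k$ disjoint paths from $U$ to $Y$ having the minimum total number of vertices among all such collections. If there is a set $A\subseteq V(D)\setminus(W\cup \mathrm{Ini}(\mathcal{Q}))$ with $|A|\leq k$ such that each vertex $a\in A$ has at least $7k+3|W|+7|A|$ out-neighbours in $D\setminus(X\cup Y\cup U)$, each of which is a $1$-in-dominator of $U\setminus\mathrm{Ini}(\mathcal{Q})$, then $A$ short anchors every subset $S\subseteq \mathrm{Ini}(\mathcal{Q})\setminus W$ with $|S|=|A|$ in the subdigraph of $D$ induced by $\bigl(V(D)\setminus(V(\mathcal{Q})\cup W\cup X)\bigr)\cup S\cup A$.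
   Context: Digraphs are finite and simple (opposite arcs allowed). Paths are directed with distinct vertices; the length is the number of arcs; "disjoint" means vertex-disjoint; two paths are independent if neither contains an interior vertex of the other. For a set $Z$ of vertices, $D\setminus Z$ is the digraph obtained by deleting $Z$. For $c\in\mathbb{N}$, a vertex $v$ is $c$-good for $u$ in a digraph $F$ if $vu\in A(F)$ or $F$ contains at least $c$ independent $(v,u)$-paths of length 2. A set $U$ of vertices of a digraph $F$ is a nearly in-dominating set of $F$ if for every $u\in U$ and every $c\in\mathbb{N}$, all but at most $2c$ vertices of $F\setminus U$ are $c$-good for $u$ in $F$. A collection of paths "from $U$ to $Y$" consists of paths each with initial vertex in $U$ and terminal vertex in $Y$. For a collection $\mathcal{Q}$ of paths, $\mathrm{Ini}(\mathcal{Q})$ is the set of initial vertices of its paths and $V(\mathcal{Q})$ the set of all its vertices. A vertex $v$ is a $1$-in-dominator of a set $Z$ if $v$ has at least one in-neighbour in $Z$. For disjoint vertex sets $A=\{a_1,\dots,a_m\}$ and $S=\{s_1,\dots,s_m\}$ in a digraph $F$, $A$ short anchors $S$ in $F$ if for every permutation $\pi$ of $[m]$ there are $m$ disjoint paths in $F$, the $i$-th from $a_i$ to $s_{\pi(i)}$, each of length at most $3$. -}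

module Defs where

open import Data.Nat using (ℕ; zero; suc; _+_; _*_; _≤_; _≥_)
open import Data.Bool using (Bool; true; false; T)
open import Data.Fin using (Fin)
open import Data.Fin.Subset using (Subset; _∈_; _∉_; ∣_∣)
open import Data.List using (List)
import Data.List as L
open import Data.List.NonEmpty using (List⁺; _∷_; toList; last)
open import Data.List.NonEmpty as L⁺ using ()
open import Data.List.Relation.Unary.All using (All)
open import Data.List.Relation.Unary.Linked using (Linked)
open import Data.List.Relation.Unary.Unique.Propositional using (Unique)
import Data.List.Membership.Propositional as M
open import Data.Fin.Permutation using (Permutation′; _⟨$⟩ʳ_)
open import Data.Product using (Σ; ∃; _×_)
open import Data.Sum using (_⊎_)
open import Relation.Binary.PropositionalEquality using (_≡_; _≢_)
open import Relation.Nullary using (¬_)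

record Digraph (n : ℕ) : Set where
  field
    adj      : Fin n → Fin n → Bool
    loopless : ∀ v → adj v v ≡ false

Arc : ∀ {n} → Digraph n → Fin n → Fin n → Set
Arc D u v = T (Digraph.adj D u v)

-- A vertex set of the ambient digraph given as a predicate; the digraph
-- "F = D[Z]" is the subdigraph of D induced by Z.
VSet : ℕ → Set₁
VSet n = Fin n → Set

Path : ℕ → Set
Path n = List⁺ (Fin n)

ini : ∀ {n} → Path n → Fin n
ini = List⁺.head

ter : ∀ {n} → Path n → Fin n
ter = last

-- number of arcs
plen : ∀ {n} → Path n → ℕ
plen p = L.length (List⁺.tail p)

_∈P_ : ∀ {n} → Fin n → Path n → Set
x ∈P p = x M.∈ toList p

IsPathIn : ∀ {n} → Digraph n → VSet n → Path n → Set
IsPathIn D Z p = All Z (toList p) × Unique (toList p) × Linked (Arc D) (toList p)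

Interior : ∀ {n} → Path n → Fin n → Set
Interior p x = x ∈P p × x ≢ ini p × x ≢ ter p

Independent : ∀ {n} → Path n → Path n → Set
Independent p q = (∀ x → Interior p x → ¬ (x ∈P q)) × (∀ x → Interior q x → ¬ (x ∈P p))

Disjoint : ∀ {n} → Path n → Path n → Set
Disjoint p q = ∀ x → x ∈P p → ¬ (x ∈P q)

CGood : ∀ {n} → Digraph n → VSet n → ℕ → Fin n → Fin n → Set
CGood D Z c v u =
  (Z v × Z u × Arc D v u) ⊎
  (Σ (Fin c → Path _) λ P →
     (∀ i → IsPathIn D Z (P i) × ini (P i) ≡ v × ter (P i) ≡ u × plen (P i) ≡ 2) ×
     (∀ i j → i ≢ j → Independent (P i) (P j)))

NearlyInDominating : ∀ {n} → Digraph n → VSet n → Subset n → Set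
NearlyInDominating {n} D Z U =
  (∀ u → u ∈ U → Z u) ×
  (∀ u → u ∈ U → ∀ (c : ℕ) → Σ (Subset n) λ B → ∣ B ∣ ≤ 2 * c ×
     (∀ v → Z v → v ∉ U → v ∉ B → CGood D Z c v u))

All-V : ∀ {n} → VSet n
All-V _ = Data.Unit.⊤
  where import Data.Unit

IsPathCollection : ∀ {n} → Digraph n → (k : ℕ) → Subset n → Subset n → (Fin k → Path n) → Set
IsPathCollection D k U Y Q =
  (∀ i → IsPathIn D All-V (Q i) × ini (Q i) ∈ U × ter (Q i) ∈ Y) ×
  (∀ i j → i ≢ j → Disjoint (Q i) (Q j))

sumFin : ∀ k → (Fin k → ℕ) → ℕ
sumFin zero f = 0
sumFin (suc k) f = f Fin.zero + sumFin k (λ i → f (Fin.suc i))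
  where import Data.Fin as Fin

totalVertices : ∀ {n k} → (Fin k → Path n) → ℕ
totalVertices {k = k} Q = sumFin k (λ i → L⁺.length (Q i))

Ini : ∀ {n k} → (Fin k → Path n) → VSet n
Ini {k = k} Q v = ∃ λ (i : Fin k) → ini (Q i) ≡ v

VQ : ∀ {n k} → (Fin k → Path n) → VSet n
VQ {k = k} Q v = ∃ λ (i : Fin k) → v ∈P Q i

ShortAnchors : ∀ {n m} → Digraph n → VSet n → (Fin m → Fin n) → (Fin m → Fin n) → Set
ShortAnchors {n} {m} D Z a s =
  ∀ (π : Permutation′ m) → Σ (Fin m → Path n) λ P →
    (∀ i → IsPathIn D Z (P i) × ini (P i) ≡ a i × ter (P i) ≡ s (π ⟨$⟩ʳ i) × plen (P i) ≤ 3) ×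
    (∀ i j → i ≢ j → Disjoint (P i) (P j))

Injective : ∀ {m n} → (Fin m → Fin n) → Set
Injective f = ∀ i j → f i ≡ f j → i ≡ j

InDominator1 : ∀ {n} → Digraph n → VSet n → Fin n → Set
InDominator1 D Z v = ∃ λ u → Z u × Arc D u v

{-# OPTIONS --safe #-}
-- Each anchor a_j is routed to its target t_j = s_(π j) through a first hop v_j = hop₁ j,
-- an out-neighbour of a_j, and then either directly or through a second hop w_j = hop₂ j,
-- the middle vertex of one of the many (v_j, t_j)-paths of length 2 that U supplies.
-- Minimality of Q keeps the hops off the paths of Q: a vertex of U outside Ini(Q) is off
-- Q, an out-neighbour of it outside U can only be the second vertex of a Q-path, and a
-- vertex two steps further on is among the first three vertices of a Q-path, since
-- otherwise the shortcut would give a collection with fewer vertices.  So the hops only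
-- have to avoid W, the anchors, the first three vertices of each Q-path and each other.
-- Choosing the w_j greedily in order asks v_j to be (|W| + 3k + 2m + j)-good, where
-- m = |A|; choosing the v_j greedily in reverse order then keeps everything v_j must
-- avoid below the 7k + 3|W| + 7m out-neighbours of a_j.
module Submission where

open import Defs
open import Data.Nat using (ℕ; zero; suc; _+_; _*_; _∸_; _≤_; _<_; _≥_; z≤n; s≤s)
open import Data.Nat.Properties
open import Data.Nat.Tactic.RingSolver using (solve-∀)
open import Data.Fin as F using (Fin; zero; suc; toℕ)
import Data.Fin.Properties as FinP
open import Data.Fin.Subset using (Subset; _∈_; _∉_; ∣_∣; inside; outside)
open import Data.Fin.Permutation using (Permutation′; _⟨$⟩ʳ_; _⟨$⟩ˡ_; inverseˡ)
open import Data.Vec using ([]; _∷_; here; there)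
open import Data.Vec.Functional using (updateAt)
open import Data.Vec.Functional.Properties using (updateAt-updates; updateAt-minimal)
open import Data.List as L using (List; []; _∷_; _++_; [_]; length; take; concatMap; allFin)
open import Data.List.Properties using (length-++; length-map; length-take; length-tabulate; ∷-injective)
open import Data.List.NonEmpty as L⁺ using (List⁺; _∷_; toList; last; _++⁺_; _∷⁺_)
open import Data.List.Membership.Propositional renaming (_∈_ to _∈ₗ_; _∉_ to _∉ₗ_)
open import Data.List.Membership.Propositional.Properties
open import Data.List.Relation.Unary.All as All using (All; []; _∷_)
open import Data.List.Relation.Unary.All.Properties using (¬Any⇒All¬)
open import Data.List.Relation.Unary.Any as Any using (here; there)
open import Data.List.Relation.Unary.Any.Properties using (lookup-index)
open import Data.List.Relation.Unary.AllPairs using ([]; _∷_)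
open import Data.List.Relation.Unary.Linked using (Linked; []; [-]; _∷_)
open import Data.List.Relation.Unary.Unique.Propositional using (Unique)
import Data.List.Relation.Unary.Unique.Propositional.Properties as Unique
open import Data.Product using (Σ; ∃; _×_; _,_; proj₁; proj₂)
open import Data.Sum using (_⊎_; inj₁; inj₂)
open import Data.Empty using (⊥; ⊥-elim)
open import Function using (_∘_; id)
open import Relation.Binary.PropositionalEquality hiding ([_])
open import Relation.Nullary using (¬_; yes; no)
open import Relation.Nullary.Decidable using (decidable-stable)

private variable
  A : Set
  n : ℕ

lookup-injective : ∀ {xs : List A} {i j} → Unique xs → L.lookup xs i ≡ L.lookup xs j → i ≡ j
lookup-injective {xs = _ ∷ _} {zero}  {zero}  _         _ = refl
lookup-injective {xs = _ ∷ _} {zero}  {suc j} (x∉ ∷ _)  e = ⊥-elim (All.lookup x∉ (∈-lookup j) e)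
lookup-injective {xs = _ ∷ _} {suc i} {zero}  (x∉ ∷ _)  e = ⊥-elim (All.lookup x∉ (∈-lookup i) (sym e))
lookup-injective {xs = _ ∷ _} {suc i} {suc j} (_ ∷ xs!) e = cong suc (lookup-injective xs! e)

pigeonhole : ∀ {xs ys : List (Fin n)} → Unique xs → length ys < length xs →
  ∃ λ x → x ∈ₗ xs × x ∉ₗ ys
pigeonhole {xs = xs} {ys} xs! ys<xs =
  let i , xsᵢ∉ys = FinP.¬∀⟶∃¬ _ (λ i → L.lookup xs i ∈ₗ ys) (λ i → Any.any? (L.lookup xs i F.≟_) ys)
                                not-all-in
  in L.lookup xs i , ∈-lookup i , xsᵢ∉ys
  where
  not-all-in : ¬ (∀ i → L.lookup xs i ∈ₗ ys)
  not-all-in all-in =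
    let i , j , i<j , same-index = FinP.pigeonhole ys<xs (λ i → Any.index (all-in i))
    in FinP.<⇒≢ i<j (lookup-injective xs! (begin
         L.lookup xs i                         ≡⟨ lookup-index (all-in i) ⟩
         L.lookup ys (Any.index (all-in i))    ≡⟨ cong (L.lookup ys) same-index ⟩
         L.lookup ys (Any.index (all-in j))    ≡⟨ lookup-index (all-in j) ⟨
         L.lookup xs j                         ∎))
    where open ≡-Reasoning

pigeonhole-≤ : ∀ {xs ys : List (Fin n)} {e} → Unique xs → e ∉ₗ xs → e ∈ₗ ys →
  length ys ≤ length xs → ∃ λ x → x ∈ₗ xs × x ∉ₗ ys
pigeonhole-≤ {xs = xs} xs! e∉xs e∈ys ys≤xs with pigeonhole (¬Any⇒All¬ xs e∉xs ∷ xs!) (s≤s ys≤xs)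
... | _ , here refl   , e∉ys = ⊥-elim (e∉ys e∈ys)
... | x , there x∈xs , x∉ys = x , x∈xs , x∉ys

length-++-≤ : ∀ (xs : List A) {ys a b} → length xs ≤ a → length ys ≤ b → length (xs ++ ys) ≤ a + b
length-++-≤ xs xs≤ ys≤ = subst (_≤ _) (sym (length-++ xs)) (+-mono-≤ xs≤ ys≤)

length-concatMap-≤ : ∀ {B : Set} (f : A → List B) {d} xs → (∀ x → length (f x) ≤ d) →
  length (concatMap f xs) ≤ length xs * d
length-concatMap-≤ f []       _   = z≤n
length-concatMap-≤ f (x ∷ xs) f≤d = length-++-≤ (f x) (f≤d x) (length-concatMap-≤ f xs f≤d)

∈-take : ∀ pre {x : A} suf {d} → length pre < d → x ∈ₗ take d (pre ++ x ∷ suf)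
∈-take []        suf {suc d} _          = here refl
∈-take (_ ∷ pre) suf {suc d} (s≤s pre<d) = there (∈-take pre suf pre<d)

unique-++⁻ʳ : ∀ (xs : List A) {ys} → Unique (xs ++ ys) → Unique ys
unique-++⁻ʳ []       ys!        = ys!
unique-++⁻ʳ (_ ∷ xs) (_ ∷ xsys!) = unique-++⁻ʳ xs xsys!

linked-++⁻ʳ : ∀ {R : A → A → Set} (xs : List A) {ys} → Linked R (xs ++ ys) → Linked R ys
linked-++⁻ʳ []           r        = r
linked-++⁻ʳ (_ ∷ [])     [-]      = []
linked-++⁻ʳ (_ ∷ [])     (_ ∷ r)  = r
linked-++⁻ʳ (_ ∷ y ∷ xs) (_ ∷ r)  = linked-++⁻ʳ (y ∷ xs) r

linked-join : ∀ {R : A → A → Set} (xs : List A) {x ys} →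
  Linked R (xs ++ [ x ]) → Linked R (x ∷ ys) → Linked R (xs ++ x ∷ ys)
linked-join []           _         r = r
linked-join (_ ∷ [])     (xy ∷ _)  r = xy ∷ r
linked-join (_ ∷ y ∷ xs) (xy ∷ r′) r = xy ∷ linked-join (y ∷ xs) r′ r

elements : Subset n → List (Fin n)
elements []            = []
elements (inside ∷ p)  = zero ∷ L.map suc (elements p)
elements (outside ∷ p) = L.map suc (elements p)

length-elements : ∀ (p : Subset n) → length (elements p) ≡ ∣ p ∣
length-elements []            = refl
length-elements (inside ∷ p)  = cong suc (trans (length-map suc (elements p)) (length-elements p))
length-elements (outside ∷ p) = trans (length-map suc (elements p)) (length-elements p)

∈-elements⁺ : ∀ {p : Subset n} {x} → x ∈ p → x ∈ₗ elements p
∈-elements⁺ {p = inside ∷ p}  here       = here refl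
∈-elements⁺ {p = inside ∷ p}  (there x∈) = there (∈-map⁺ suc (∈-elements⁺ x∈))
∈-elements⁺ {p = outside ∷ p} (there x∈) = ∈-map⁺ suc (∈-elements⁺ x∈)

∈-elements⁻ : ∀ {p : Subset n} {x} → x ∈ₗ elements p → x ∈ p
∈-elements⁻ {p = inside ∷ p}  (here refl) = here
∈-elements⁻ {p = inside ∷ p}  (there x∈) with ∈-map⁻ suc x∈
... | _ , y∈ , refl = there (∈-elements⁻ y∈)
∈-elements⁻ {p = outside ∷ p} x∈ with ∈-map⁻ suc x∈
... | _ , y∈ , refl = there (∈-elements⁻ y∈)

elements-unique : ∀ (p : Subset n) → Unique (elements p)
elements-unique []            = []
elements-unique (inside ∷ p)  =
  ¬Any⇒All¬ _ zero∉ ∷ Unique.map⁺ FinP.suc-injective (elements-unique p)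
  where
  zero∉ : zero ∉ₗ L.map suc (elements p)
  zero∉ x∈ with ∈-map⁻ suc x∈
  ... | _ , _ , ()
elements-unique (outside ∷ p) = Unique.map⁺ FinP.suc-injective (elements-unique p)

toList-injective : ∀ {p q : List⁺ A} → toList p ≡ toList q → p ≡ q
toList-injective refl = refl

toList-++⁺ : ∀ (xs : List A) ys → toList (xs ++⁺ ys) ≡ xs ++ toList ys
toList-++⁺ []       _  = refl
toList-++⁺ (x ∷ xs) ys = cong (x ∷_) (toList-++⁺ xs ys)

last-∷⁺ : ∀ (x : A) ys → last (x ∷⁺ ys) ≡ last ys
last-∷⁺ x (y ∷ zs) with L.initLast zs
... | []        = refl
... | _ L.∷ʳ′ _ = refl

last-++⁺ : ∀ (xs : List A) ys → last (xs ++⁺ ys) ≡ last ys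
last-++⁺ []       _  = refl
last-++⁺ (x ∷ xs) ys = trans (last-∷⁺ x (xs ++⁺ ys)) (last-++⁺ xs ys)

sumFin-mono : ∀ k (f g : Fin k → ℕ) → (∀ i → f i ≤ g i) → sumFin k f ≤ sumFin k g
sumFin-mono zero    f g f≤g = z≤n
sumFin-mono (suc k) f g f≤g = +-mono-≤ (f≤g zero) (sumFin-mono k (f ∘ suc) (g ∘ suc) (f≤g ∘ suc))

sumFin-mono-< : ∀ k (f g : Fin k → ℕ) l → (∀ i → f i ≤ g i) → f l < g l → sumFin k f < sumFin k g
sumFin-mono-< (suc k) f g zero    f≤g fl<gl =
  +-mono-<-≤ fl<gl (sumFin-mono k (f ∘ suc) (g ∘ suc) (f≤g ∘ suc))
sumFin-mono-< (suc k) f g (suc l) f≤g fl<gl =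
  +-mono-≤-< (f≤g zero) (sumFin-mono-< k (f ∘ suc) (g ∘ suc) l (f≤g ∘ suc) fl<gl)

injective-choice : ∀ {n} m (P : Fin m → Fin n → Set) →
  (∀ j (used : List (Fin n)) → length used ≤ toℕ j →
     All (λ y → ∃ λ i → i ≢ j × P i y) used → ∃ λ x → P j x × x ∉ₗ used) →
  ∃ λ (f : Fin m → Fin n) → (∀ j → P j (f j)) × Injective f
injective-choice zero    P choose = (λ ()) , (λ ()) , (λ ())
injective-choice {n} (suc m) P choose = f , f-ok , f-inj
  where
  first : ∃ λ x → P zero x × x ∉ₗ []
  first = choose zero [] z≤n []
  x₀ : Fin n
  x₀ = proj₁ first
  P′ : Fin m → Fin n → Set
  P′ j y = P (suc j) y × y ≢ x₀
  shift : ∀ {j y} → (∃ λ i → i ≢ j × P′ i y) → ∃ λ i → i ≢ suc j × P i y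
  shift (i , i≢j , Py , _) = suc i , i≢j ∘ FinP.suc-injective , Py
  choose′ : ∀ j used → length used ≤ toℕ j → All (λ y → ∃ λ i → i ≢ j × P′ i y) used →
    ∃ λ x → P′ j x × x ∉ₗ used
  choose′ j used used≤j earlier
    with x , Px , x∉ ← choose (suc j) (x₀ ∷ used) (s≤s used≤j)
                         ((zero , (λ ()) , proj₁ (proj₂ first)) ∷ All.map shift earlier)
    = x , (Px , x∉ ∘ here) , x∉ ∘ there
  rest : ∃ λ (g : Fin m → Fin n) → (∀ j → P′ j (g j)) × Injective g
  rest = injective-choice m P′ choose′
  f : Fin (suc m) → Fin n
  f zero    = x₀
  f (suc j) = proj₁ rest j
  f-ok : ∀ j → P j (f j)
  f-ok zero    = proj₁ (proj₂ first)
  f-ok (suc j) = proj₁ (proj₁ (proj₂ rest) j)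
  f-inj : Injective f
  f-inj zero    zero    _ = refl
  f-inj zero    (suc j) e = ⊥-elim (proj₂ (proj₁ (proj₂ rest) j) (sym e))
  f-inj (suc i) zero    e = ⊥-elim (proj₂ (proj₁ (proj₂ rest) i) e)
  f-inj (suc i) (suc j) e = cong suc (proj₂ (proj₂ rest) i j e)

injective-choice-reversed : ∀ {n} m (P : Fin m → Fin n → Set) →
  (∀ j (used : List (Fin n)) → length used ≤ m ∸ suc (toℕ j) → ∃ λ x → P j x × x ∉ₗ used) →
  ∃ λ (f : Fin m → Fin n) → (∀ j → P j (f j)) × Injective f
injective-choice-reversed {n} m P choose = f ∘ F.opposite , f-ok′ , λ i j e → opposite-injective (f-inj _ _ e)
  where
  choose′ : ∀ j used → length used ≤ toℕ j → All (λ y → ∃ λ i → i ≢ j × P (F.opposite i) y) used →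
    ∃ λ x → P (F.opposite j) x × x ∉ₗ used
  choose′ j used used≤j _ = choose (F.opposite j) used (begin
    length used                                  ≤⟨ used≤j ⟩
    toℕ j                                        ≡⟨ cong toℕ (FinP.opposite-involutive j) ⟨
    toℕ (F.opposite (F.opposite j))              ≡⟨ FinP.opposite-prop (F.opposite j) ⟩
    m ∸ suc (toℕ (F.opposite j))                 ∎)
    where open ≤-Reasoning
  chosen : ∃ λ (g : Fin m → Fin n) → (∀ j → P (F.opposite j) (g j)) × Injective g
  chosen = injective-choice m (P ∘ F.opposite) choose′
  f : Fin m → Fin n
  f = proj₁ chosen
  f-inj : Injective f
  f-inj = proj₂ (proj₂ chosen)
  f-ok′ : ∀ j → P j (f (F.opposite j))
  f-ok′ j = subst (λ i → P i (f (F.opposite j))) (FinP.opposite-involutive j)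
                  (proj₁ (proj₂ chosen) (F.opposite j))
  opposite-injective : ∀ {i j : Fin m} → F.opposite i ≡ F.opposite j → i ≡ j
  opposite-injective {i} {j} e =
    trans (sym (FinP.opposite-involutive i)) (trans (cong F.opposite e) (FinP.opposite-involutive j))

arc-irreflexive : ∀ (D : Digraph n) {u v} → Arc D u v → u ≢ v
arc-irreflexive D {u} uv refl rewrite Digraph.loopless D u = uv

module _ (D : Digraph n) (Z : VSet n) where

  path₂-middle : ∀ {p} → IsPathIn D Z p → plen p ≡ 2 →
    Σ (Fin n) λ y → Interior p y × Arc D (ini p) y × Arc D y (ter p) × Z y
  path₂-middle {x ∷ y ∷ z ∷ []} (_ ∷ Zy ∷ _ , (x≢y ∷ _) ∷ (y≢z ∷ []) ∷ _ , xy ∷ yz ∷ [-]) refl =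
    y , (there (here refl) , x≢y ∘ sym , y≢z) , xy , yz , Zy

  CGood⇒arc⊎middles : ∀ {c v u} → CGood D Z c v u →
    Arc D v u ⊎
    Σ (Fin c → Fin n) λ mid → Injective mid × (∀ i → Arc D v (mid i) × Arc D (mid i) u × Z (mid i))
  CGood⇒arc⊎middles (inj₁ (_ , _ , vu)) = inj₁ vu
  CGood⇒arc⊎middles {c} {v} {u} (inj₂ (P , P-ok , P-independent)) = inj₂ (mid , mid-injective , mid-ok)
    where
    middle : ∀ i → Σ (Fin n) λ y → Interior (P i) y × Arc D (ini (P i)) y × Arc D y (ter (P i)) × Z y
    middle i = let P-path , _ , _ , P-length = P-ok i in path₂-middle P-path P-length
    mid : Fin c → Fin n
    mid i = proj₁ (middle i)
    mid-ok : ∀ i → Arc D v (mid i) × Arc D (mid i) u × Z (mid i)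
    mid-ok i with _ , P-ini , P-ter , _ ← P-ok i | _ , _ , to-mid , from-mid , Z-mid ← middle i
      = subst (λ x → Arc D x _) P-ini to-mid , subst (Arc D _) P-ter from-mid , Z-mid
    mid-injective : Injective mid
    mid-injective i j same = decidable-stable (i F.≟ j) λ i≢j →
      proj₁ (P-independent i j i≢j) (mid i) (proj₁ (proj₂ (middle i)))
        (subst (_∈P P j) (sym same) (proj₁ (proj₁ (proj₂ (middle j)))))

module Rerouting {n k} (D : Digraph n) (U Y : Subset n) (Q : Fin k → Path n)
  (Q-paths : IsPathCollection D k U Y Q)
  (Q-min : ∀ Q′ → IsPathCollection D k U Y Q′ → totalVertices Q ≤ totalVertices Q′) where

  OffQ : Fin n → Set
  OffQ x = ¬ VQ Q x

  no-shorter-replacement : ∀ l (R : Path n) → IsPathIn D All-V R → ini R ∈ U → ter R ≡ ter (Q l) →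
    (∀ i → i ≢ l → Disjoint R (Q i)) → L⁺.length (Q l) ≤ L⁺.length R
  no-shorter-replacement l R R-path R-ini R-ter R-disjoint =
    ≮⇒≥ λ R<Qₗ → <⇒≱ (total-< R<Qₗ) (Q-min Q′ Q′-paths)
    where
    Q′ : Fin k → Path n
    Q′ = updateAt Q l (λ _ → R)
    Q′-cases : ∀ i → (i ≡ l × Q′ i ≡ R) ⊎ (i ≢ l × Q′ i ≡ Q i)
    Q′-cases i with i F.≟ l
    ... | yes refl = inj₁ (refl , updateAt-updates l Q)
    ... | no i≢l   = inj₂ (i≢l , updateAt-minimal i l Q i≢l)
    Q′-path : ∀ i → IsPathIn D All-V (Q′ i) × ini (Q′ i) ∈ U × ter (Q′ i) ∈ Y
    Q′-path i with Q′-cases i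
    ... | inj₁ (refl , Q′ₗ≡R) rewrite Q′ₗ≡R =
      R-path , R-ini , subst (_∈ Y) (sym R-ter) (proj₂ (proj₂ (proj₁ Q-paths l)))
    ... | inj₂ (_ , Q′ᵢ≡Qᵢ) rewrite Q′ᵢ≡Qᵢ = proj₁ Q-paths i
    Q′-disjoint : ∀ i j → i ≢ j → Disjoint (Q′ i) (Q′ j)
    Q′-disjoint i j i≢j with Q′-cases i | Q′-cases j
    ... | inj₁ (refl , _) | inj₁ (refl , _) = ⊥-elim (i≢j refl)
    ... | inj₁ (_ , e) | inj₂ (j≢l , e′) rewrite e | e′ = R-disjoint j j≢l
    ... | inj₂ (i≢l , e) | inj₁ (_ , e′) rewrite e | e′ =
      λ x x∈Qᵢ x∈R → R-disjoint i i≢l x x∈R x∈Qᵢ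
    ... | inj₂ (_ , e) | inj₂ (_ , e′) rewrite e | e′ = proj₂ Q-paths i j i≢j
    Q′-paths : IsPathCollection D k U Y Q′
    Q′-paths = Q′-path , Q′-disjoint
    total-< : L⁺.length R < L⁺.length (Q l) → totalVertices Q′ < totalVertices Q
    total-< R<Qₗ = sumFin-mono-< k (λ i → L⁺.length (Q′ i)) (λ i → L⁺.length (Q i)) l Q′≤Q Q′ₗ<Qₗ
      where
      Q′≤Q : ∀ i → L⁺.length (Q′ i) ≤ L⁺.length (Q i)
      Q′≤Q i with Q′-cases i
      ... | inj₁ (refl , e) rewrite e = <⇒≤ R<Qₗ
      ... | inj₂ (_ , e) rewrite e = ≤-refl
      Q′ₗ<Qₗ : L⁺.length (Q′ l) < L⁺.length (Q l)
      Q′ₗ<Qₗ rewrite updateAt-updates l {λ _ → R} Q = R<Qₗ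

  shortcut-bound : ∀ l pre x suf → toList (Q l) ≡ pre ++ x ∷ suf → (P : List (Fin n)) →
    All OffQ P → Unique P → Linked (Arc D) (P ++ [ x ]) → ini (P ++⁺ x ∷ suf) ∈ U →
    length pre ≤ length P
  shortcut-bound l pre x suf Qₗ≡ P P-off P! P-linked R-ini = +-cancelʳ-≤ (length (x ∷ suf)) _ _ lengths
    where
    R : Path n
    R = P ++⁺ x ∷ suf
    R≡ : toList R ≡ P ++ x ∷ suf
    R≡ = toList-++⁺ P (x ∷ suf)
    suf-on-Qₗ : ∀ {y} → y ∈ₗ x ∷ suf → y ∈P Q l
    suf-on-Qₗ y∈suf = subst (_ ∈ₗ_) (sym Qₗ≡) (∈-++⁺ʳ pre y∈suf)
    R-vertex : ∀ {y} → y ∈P R → y ∈ₗ P ⊎ y ∈P Q l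
    R-vertex y∈R with ∈-++⁻ P (subst (_ ∈ₗ_) R≡ y∈R)
    ... | inj₁ y∈P   = inj₁ y∈P
    ... | inj₂ y∈suf = inj₂ (suf-on-Qₗ y∈suf)
    Qₗ-path : IsPathIn D All-V (Q l)
    Qₗ-path = proj₁ (proj₁ Q-paths l)
    R-path : IsPathIn D All-V R
    R-path = All.universal _ _
           , subst Unique (sym R≡) (Unique.++⁺ P! suf!
               λ (y∈P , y∈suf) → All.lookup P-off y∈P (l , suf-on-Qₗ y∈suf))
           , subst (Linked (Arc D)) (sym R≡) (linked-join P P-linked suf-linked)
      where
      suf! : Unique (x ∷ suf)
      suf! = unique-++⁻ʳ pre (subst Unique Qₗ≡ (proj₁ (proj₂ Qₗ-path)))
      suf-linked : Linked (Arc D) (x ∷ suf)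
      suf-linked = linked-++⁻ʳ pre (subst (Linked (Arc D)) Qₗ≡ (proj₂ (proj₂ Qₗ-path)))
    R-ter : ter R ≡ ter (Q l)
    R-ter = begin
      last (P ++⁺ x ∷ suf)    ≡⟨ last-++⁺ P (x ∷ suf) ⟩
      last (x ∷ suf)          ≡⟨ last-++⁺ pre (x ∷ suf) ⟨
      last (pre ++⁺ x ∷ suf)  ≡⟨ cong last (toList-injective (trans (toList-++⁺ pre _) (sym Qₗ≡))) ⟩
      last (Q l)              ∎
      where open ≡-Reasoning
    R-disjoint : ∀ i → i ≢ l → Disjoint R (Q i)
    R-disjoint i i≢l y y∈R y∈Qᵢ with R-vertex y∈R
    ... | inj₁ y∈P  = All.lookup P-off y∈P (i , y∈Qᵢ)
    ... | inj₂ y∈Qₗ = proj₂ Q-paths l i (i≢l ∘ sym) y y∈Qₗ y∈Qᵢ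
    lengths : length pre + length (x ∷ suf) ≤ length P + length (x ∷ suf)
    lengths = begin
      length pre + length (x ∷ suf)  ≡⟨ length-++ pre ⟨
      length (pre ++ x ∷ suf)        ≡⟨ cong length Qₗ≡ ⟨
      L⁺.length (Q l)                ≤⟨ no-shorter-replacement l R R-path R-ini R-ter R-disjoint ⟩
      L⁺.length R                    ≡⟨ cong length R≡ ⟩
      length (P ++ x ∷ suf)          ≡⟨ length-++ P ⟩
      length P + length (x ∷ suf)    ∎
      where open ≤-Reasoning

  off-paths : ∀ {u} → u ∈ U → ¬ Ini Q u → OffQ u
  off-paths u∈U u∉Ini (l , u∈Qₗ) with ∈-∃++ u∈Qₗ
  ... | [] , _ , Qₗ≡ = u∉Ini (l , proj₁ (∷-injective Qₗ≡))
  ... | p ∷ pre , suf , Qₗ≡ with shortcut-bound l (p ∷ pre) _ suf Qₗ≡ [] [] [] [-] u∈U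
  ... | ()

  reached-early : ∀ {u x} P l → u ∈ U → All OffQ (u ∷ P) → Unique (u ∷ P) →
    Linked (Arc D) (u ∷ P ++ [ x ]) → x ∈P Q l → x ∈ₗ take (2 + length P) (toList (Q l))
  reached-early {u} {x} P l u∈U uP-off uP! uPx-linked x∈Qₗ with ∈-∃++ x∈Qₗ
  ... | pre , suf , Qₗ≡ = subst (λ xs → x ∈ₗ take (2 + length P) xs) (sym Qₗ≡)
          (∈-take pre suf (s≤s (shortcut-bound l pre x suf Qₗ≡ (u ∷ P) uP-off uP! uPx-linked u∈U)))

  second-vertex : ∀ {u x} l → u ∈ U → OffQ u → Arc D u x → x ∉ U → x ∈P Q l →
    x ∈ₗ take 1 (L⁺.tail (Q l))
  second-vertex l u∈U u-off ux x∉U x∈Qₗ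
    with reached-early [] l u∈U (u-off ∷ []) ([] ∷ []) (ux ∷ [-]) x∈Qₗ
  ... | here refl = ⊥-elim (x∉U (proj₁ (proj₂ (proj₁ Q-paths l))))
  ... | there x∈  = x∈

  within-first-three : ∀ {u v x} l → u ∈ U → OffQ u → OffQ v → Arc D u v → Arc D v x → x ∈P Q l →
    x ∈ₗ take 3 (toList (Q l))
  within-first-three l u∈U u-off v-off uv vx =
    reached-early [ _ ] l u∈U (u-off ∷ v-off ∷ []) ((arc-irreflexive D uv ∷ []) ∷ [] ∷ []) (uv ∷ vx ∷ [-])

first-hop-budget : ∀ w k m j → j < m →
  2 * (w + (k * 3 + (m + (m + j)))) + (w + (k * 1 + (m + (m ∸ suc j)))) < 7 * k + 3 * w + 7 * m
first-hop-budget w k m j j<m =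
  subst (λ m′ → 2 * (w + (k * 3 + (m′ + (m′ + j)))) + (w + (k * 1 + (m′ + d))) < 7 * k + 3 * w + 7 * m′)
        (m+[n∸m]≡n j<m) (m+n≤o⇒m≤o _ (≤-reflexive (identity w k j d)))
  where
  d : ℕ
  d = m ∸ suc j
  identity : ∀ w k j d →
    suc (2 * (w + (k * 3 + (suc (j + d) + (suc (j + d) + j)))) + (w + (k * 1 + (suc (j + d) + d)))) + suc d
      ≡ 7 * k + 3 * w + 7 * suc (j + d)
  identity = solve-∀

length-take-≤ : ∀ d (xs : List A) → length (take d xs) ≤ d
length-take-≤ d xs = ≤-trans (≤-reflexive (length-take d xs)) (m⊓n≤m d _)

length-image : ∀ {m} (f : Fin m → A) → length (L.map f (allFin m)) ≡ m
length-image {m = m} f = trans (length-map f (allFin m)) (length-tabulate {n = m} id)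

module Anchoring {n} (k : ℕ) (D : Digraph n) (X Y W U : Subset n)
    (U-dom : NearlyInDominating D (λ v → v ∉ X × v ∉ Y) U)
    (Q : Fin k → Path n) (Q-paths : IsPathCollection D k U Y Q)
    (Q-min : ∀ (Q′ : Fin k → Path n) → IsPathCollection D k U Y Q′ → totalVertices Q ≤ totalVertices Q′)
    (m : ℕ) (a : Fin m → Fin n) (a-inj : Injective a)
    (a-ok : ∀ i → a i ∉ W × ¬ Ini Q (a i))
    (a-out : ∀ i → Σ (Subset n) λ B → ∣ B ∣ ≥ 7 * k + 3 * ∣ W ∣ + 7 * m ×
       (∀ v → v ∈ B → Arc D (a i) v × v ∉ X × v ∉ Y × v ∉ U ×
          InDominator1 D (λ u → u ∈ U × ¬ Ini Q u) v))
    (s : Fin m → Fin n) (s-inj : Injective s) (s-ok : ∀ i → Ini Q (s i) × s i ∉ W)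
    (π : Permutation′ m) where

  open Rerouting D U Y Q Q-paths Q-min

  OutsideXY : VSet n
  OutsideXY v = v ∉ X × v ∉ Y

  Host : VSet n
  Host v = (¬ VQ Q v × v ∉ W × v ∉ X) ⊎ (∃ λ i → s i ≡ v) ⊎ (∃ λ i → a i ≡ v)

  target : Fin m → Fin n
  target j = s (π ⟨$⟩ʳ j)

  target-injective : Injective target
  target-injective i j same =
    trans (sym (inverseˡ π)) (trans (cong (π ⟨$⟩ˡ_) (s-inj _ _ same)) (inverseˡ π))

  target-Ini : ∀ j → Ini Q (target j)
  target-Ini j = proj₁ (s-ok (π ⟨$⟩ʳ j))

  target-∈U : ∀ j → target j ∈ U
  target-∈U j = let l , ini≡ = target-Ini j in subst (_∈ U) ini≡ (proj₁ (proj₂ (proj₁ Q-paths l)))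

  target-on-Q : ∀ j → VQ Q (target j)
  target-on-Q j = let l , ini≡ = target-Ini j in l , subst (_∈P Q l) ini≡ (here refl)

  gather : (Path n → List (Fin n)) → List (Fin n)
  gather f = concatMap (f ∘ Q) (allFin k)

  length-gather : ∀ f {d} → (∀ p → length (f p) ≤ d) → length (gather f) ≤ k * d
  length-gather f {d} f≤d = subst (λ k′ → length (gather f) ≤ k′ * d) (length-tabulate {n = k} id)
    (length-concatMap-≤ (f ∘ Q) (allFin k) (f≤d ∘ Q))

  ∈-gather : ∀ f {x} l → x ∈ₗ f (Q l) → x ∈ₗ gather f
  ∈-gather f l x∈ = ∈-concat⁺′ x∈ (∈-map⁺ (f ∘ Q) (∈-allFin l))

  secondVertices : List (Fin n)
  secondVertices = gather (λ p → take 1 (L⁺.tail p))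

  firstThreeVertices : List (Fin n)
  firstThreeVertices = gather (λ p → take 3 (toList p))

  anchors : List (Fin n)
  anchors = L.map a (allFin m)

  goodness : Fin m → ℕ
  goodness j = ∣ W ∣ + (k * 3 + (m + (m + toℕ j)))

  out-nbrs : Fin m → Subset n
  out-nbrs j = proj₁ (a-out j)

  record FirstHop (j : Fin m) (x : Fin n) : Set where
    field
      out-nbr    : x ∈ out-nbrs j
      ∉W         : x ∉ W
      not-second : x ∉ₗ secondVertices
      not-anchor : x ∉ₗ anchors
      good       : CGood D OutsideXY (goodness j) x (target j)

  module _ (j : Fin m) (used : List (Fin n)) (used≤ : length used ≤ m ∸ suc (toℕ j)) where

    private
      not-good : Σ (Subset n) λ B → ∣ B ∣ ≤ 2 * goodness j ×
        (∀ v → OutsideXY v → v ∉ U → v ∉ B → CGood D OutsideXY (goodness j) v (target j))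
      not-good = proj₂ U-dom (target j) (target-∈U j) (goodness j)

      bad′ W′ excluded : List (Fin n)
      bad′ = elements (proj₁ not-good)
      W′ = elements W
      excluded = bad′ ++ W′ ++ secondVertices ++ anchors ++ used

      excluded<out-nbrs : length excluded < length (elements (out-nbrs j))
      excluded<out-nbrs = begin-strict
        length excluded
          ≤⟨ length-++-≤ bad′
               (≤-trans (≤-reflexive (length-elements (proj₁ not-good))) (proj₁ (proj₂ not-good)))
               (length-++-≤ W′ (≤-reflexive (length-elements W))
                 (length-++-≤ secondVertices
                   (length-gather (λ p → take 1 (L⁺.tail p)) (λ p → length-take-≤ 1 (L⁺.tail p)))
                   (length-++-≤ anchors (≤-reflexive (length-image a)) used≤))) ⟩
        2 * goodness j + (∣ W ∣ + (k * 1 + (m + (m ∸ suc (toℕ j)))))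
          <⟨ first-hop-budget ∣ W ∣ k m (toℕ j) (FinP.toℕ<n j) ⟩
        7 * k + 3 * ∣ W ∣ + 7 * m
          ≤⟨ proj₁ (proj₂ (a-out j)) ⟩
        ∣ out-nbrs j ∣
          ≡⟨ length-elements (out-nbrs j) ⟨
        length (elements (out-nbrs j)) ∎
        where open ≤-Reasoning

    first-hop-exists : ∃ λ x → FirstHop j x × x ∉ₗ used
    first-hop-exists
      with x , x∈out′ , x∉ ← pigeonhole (elements-unique (out-nbrs j)) excluded<out-nbrs
      = x , hop , x∉ ∘ ∈-++⁺ʳ bad′ ∘ ∈-++⁺ʳ W′ ∘ ∈-++⁺ʳ secondVertices ∘ ∈-++⁺ʳ anchors
      where
      x∈out : x ∈ out-nbrs j
      x∈out = ∈-elements⁻ x∈out′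
      hop : FirstHop j x
      hop = record
        { out-nbr    = x∈out
        ; ∉W         = x∉ ∘ ∈-++⁺ʳ bad′ ∘ ∈-++⁺ˡ ∘ ∈-elements⁺
        ; not-second = x∉ ∘ ∈-++⁺ʳ bad′ ∘ ∈-++⁺ʳ W′ ∘ ∈-++⁺ˡ
        ; not-anchor = x∉ ∘ ∈-++⁺ʳ bad′ ∘ ∈-++⁺ʳ W′ ∘ ∈-++⁺ʳ secondVertices ∘ ∈-++⁺ˡ
        ; good       = let _ , ∉X , ∉Y , ∉U , _ = proj₂ (proj₂ (a-out j)) x x∈out
                       in proj₂ (proj₂ not-good) x (∉X , ∉Y) ∉U (x∉ ∘ ∈-++⁺ˡ ∘ ∈-elements⁺)
        }

  -- Abstract so that unification never unfolds the greedy constructions.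
  abstract
    first-hops : ∃ λ (v : Fin m → Fin n) → (∀ j → FirstHop j (v j)) × Injective v
    first-hops = injective-choice-reversed m FirstHop first-hop-exists

  hop₁ : Fin m → Fin n
  hop₁ = proj₁ first-hops

  hop₁-ok : ∀ j → FirstHop j (hop₁ j)
  hop₁-ok = proj₁ (proj₂ first-hops)

  hop₁-injective : Injective hop₁
  hop₁-injective = proj₂ (proj₂ first-hops)

  hop₁-out-nbr : ∀ j → Arc D (a j) (hop₁ j) × hop₁ j ∉ X × hop₁ j ∉ Y × hop₁ j ∉ U ×
    InDominator1 D (λ u → u ∈ U × ¬ Ini Q u) (hop₁ j)
  hop₁-out-nbr j = proj₂ (proj₂ (a-out j)) (hop₁ j) (FirstHop.out-nbr (hop₁-ok j))

  hop₁∉U : ∀ j → hop₁ j ∉ U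
  hop₁∉U j = let _ , _ , _ , ∉U , _ = hop₁-out-nbr j in ∉U

  hop₁-in-nbr : Fin m → Fin n
  hop₁-in-nbr j = let _ , _ , _ , _ , u , _ = hop₁-out-nbr j in u

  hop₁-in-nbr-∈U : ∀ j → hop₁-in-nbr j ∈ U
  hop₁-in-nbr-∈U j = let _ , _ , _ , _ , _ , (∈U , _) , _ = hop₁-out-nbr j in ∈U

  hop₁-in-nbr-off-Q : ∀ j → OffQ (hop₁-in-nbr j)
  hop₁-in-nbr-off-Q j = let _ , _ , _ , _ , _ , (∈U , ∉Ini) , _ = hop₁-out-nbr j in off-paths ∈U ∉Ini

  hop₁-in-nbr→hop₁ : ∀ j → Arc D (hop₁-in-nbr j) (hop₁ j)
  hop₁-in-nbr→hop₁ j = let _ , _ , _ , _ , _ , _ , arc = hop₁-out-nbr j in arc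

  hop₁-off-Q : ∀ j → OffQ (hop₁ j)
  hop₁-off-Q j (l , v∈Qₗ) = FirstHop.not-second (hop₁-ok j) (∈-gather (λ p → take 1 (L⁺.tail p)) l
    (second-vertex l (hop₁-in-nbr-∈U j) (hop₁-in-nbr-off-Q j) (hop₁-in-nbr→hop₁ j) (hop₁∉U j) v∈Qₗ))

  anchor∈anchors : ∀ i → a i ∈ₗ anchors
  anchor∈anchors i = ∈-map⁺ a (∈-allFin i)

  anchor≢hop₁ : ∀ i j → a i ≢ hop₁ j
  anchor≢hop₁ i j e = FirstHop.not-anchor (hop₁-ok j) (subst (_∈ₗ anchors) e (anchor∈anchors i))

  firstHops : List (Fin n)
  firstHops = L.map hop₁ (allFin m)

  hop₁∈firstHops : ∀ i → hop₁ i ∈ₗ firstHops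
  hop₁∈firstHops i = ∈-map⁺ hop₁ (∈-allFin i)

  record Detour (j : Fin m) (x : Fin n) : Set where
    field
      ∉W         : x ∉ W
      off-Q      : OffQ x
      ∉X         : x ∉ X
      not-anchor : ∀ i → a i ≢ x
      not-hop₁   : ∀ i → hop₁ i ≢ x
      from-hop₁  : Arc D (hop₁ j) x
      to-target  : Arc D x (target j)

  SecondHop : Fin m → Fin n → Set
  SecondHop j x = (x ≡ hop₁ j × Arc D (hop₁ j) (target j)) ⊎ Detour j x

  hop₁-not-others-second-hop : ∀ {i j y} → SecondHop i y → i ≢ j → hop₁ j ≢ y
  hop₁-not-others-second-hop {i} {j} (inj₁ (refl , _)) i≢j vⱼ≡vᵢ =
    i≢j (hop₁-injective i j (sym vⱼ≡vᵢ))
  hop₁-not-others-second-hop {j = j} (inj₂ detour) _ = Detour.not-hop₁ detour j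

  module _ (j : Fin m) (used : List (Fin n)) (used≤ : length used ≤ toℕ j)
           (mid : Fin (goodness j) → Fin n) (mid-injective : Injective mid)
           (mid-ok : ∀ i → Arc D (hop₁ j) (mid i) × Arc D (mid i) (target j) × OutsideXY (mid i)) where

    private
      W′ middles excluded : List (Fin n)
      W′ = elements W
      middles = L.map mid (allFin (goodness j))
      excluded = W′ ++ firstThreeVertices ++ anchors ++ firstHops ++ used

      excluded≤middles : length excluded ≤ length middles
      excluded≤middles = begin
        length excluded
          ≤⟨ length-++-≤ W′ (≤-reflexive (length-elements W))
               (length-++-≤ firstThreeVertices
                 (length-gather (λ p → take 3 (toList p)) (λ p → length-take-≤ 3 (toList p)))
                 (length-++-≤ anchors (≤-reflexive (length-image a))
                   (length-++-≤ firstHops (≤-reflexive (length-image hop₁)) used≤))) ⟩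
        goodness j       ≡⟨ length-image mid ⟨
        length middles   ∎
        where open ≤-Reasoning

      hop₁∉middles : hop₁ j ∉ₗ middles
      hop₁∉middles v∈ = let i , _ , v≡ = ∈-map⁻ mid v∈ in arc-irreflexive D (proj₁ (mid-ok i)) v≡

      anchor∈excluded : ∀ i → a i ∈ₗ excluded
      anchor∈excluded i = ∈-++⁺ʳ W′ (∈-++⁺ʳ firstThreeVertices (∈-++⁺ˡ (anchor∈anchors i)))

      hop₁∈excluded : ∀ i → hop₁ i ∈ₗ excluded
      hop₁∈excluded i = ∈-++⁺ʳ W′ (∈-++⁺ʳ firstThreeVertices (∈-++⁺ʳ anchors (∈-++⁺ˡ (hop₁∈firstHops i))))

      middles-unique : Unique middles
      middles-unique = Unique.map⁺ (λ {i} {i′} → mid-injective i i′) (Unique.allFin⁺ (goodness j))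

    detour-exists : ∃ λ x → Detour j x × x ∉ₗ used
    detour-exists
      with x , x∈middles , x∉ ← pigeonhole-≤ middles-unique hop₁∉middles (hop₁∈excluded j) excluded≤middles
      with i , _ , refl ← ∈-map⁻ mid x∈middles
      = mid i , detour , x∉ ∘ ∈-++⁺ʳ W′ ∘ ∈-++⁺ʳ firstThreeVertices ∘ ∈-++⁺ʳ anchors ∘ ∈-++⁺ʳ firstHops
      where
      v→x : Arc D (hop₁ j) (mid i)
      v→x = proj₁ (mid-ok i)
      early : ∀ {l} → mid i ∈P Q l → mid i ∈ₗ take 3 (toList (Q l))
      early {l} = within-first-three l (hop₁-in-nbr-∈U j) (hop₁-in-nbr-off-Q j) (hop₁-off-Q j)
                    (hop₁-in-nbr→hop₁ j) v→x
      detour : Detour j (mid i)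
      detour = record
        { ∉W         = x∉ ∘ ∈-++⁺ˡ ∘ ∈-elements⁺
        ; off-Q      = λ (l , x∈Qₗ) → x∉ (∈-++⁺ʳ W′ (∈-++⁺ˡ (∈-gather (λ p → take 3 (toList p)) l (early x∈Qₗ))))
        ; ∉X         = proj₁ (proj₂ (proj₂ (mid-ok i)))
        ; not-anchor = λ i′ e → x∉ (subst (_∈ₗ excluded) e (anchor∈excluded i′))
        ; not-hop₁   = λ i′ e → x∉ (subst (_∈ₗ excluded) e (hop₁∈excluded i′))
        ; from-hop₁  = v→x
        ; to-target  = proj₁ (proj₂ (mid-ok i))
        }

  second-hop-exists : ∀ j (used : List (Fin n)) → length used ≤ toℕ j →
    All (λ y → ∃ λ i → i ≢ j × SecondHop i y) used → ∃ λ x → SecondHop j x × x ∉ₗ used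
  second-hop-exists j used used≤ earlier with CGood⇒arc⊎middles D OutsideXY (FirstHop.good (hop₁-ok j))
  ... | inj₁ direct = hop₁ j , inj₁ (refl , direct) , λ v∈used →
          let i , i≢j , hop = All.lookup earlier v∈used in hop₁-not-others-second-hop hop i≢j refl
  ... | inj₂ (mid , mid-injective , mid-ok) =
          let x , detour , x∉ = detour-exists j used used≤ mid mid-injective mid-ok in x , inj₂ detour , x∉

  abstract
    second-hops : ∃ λ (w : Fin m → Fin n) → (∀ j → SecondHop j (w j)) × Injective w
    second-hops = injective-choice m SecondHop second-hop-exists

  hop₂ : Fin m → Fin n
  hop₂ = proj₁ second-hops

  hop₂-ok : ∀ j → SecondHop j (hop₂ j)
  hop₂-ok = proj₁ (proj₂ second-hops)

  hop₂-injective : Injective hop₂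
  hop₂-injective = proj₂ (proj₂ second-hops)

  anchor≢target : ∀ i j → a i ≢ target j
  anchor≢target i j e = proj₂ (a-ok i) (subst (Ini Q) (sym e) (target-Ini j))

  hop₁≢target : ∀ i j → hop₁ i ≢ target j
  hop₁≢target i j e = hop₁∉U i (subst (_∈ U) (sym e) (target-∈U j))

  anchor≢hop₂ : ∀ i j → a i ≢ hop₂ j
  anchor≢hop₂ i j with hop₂-ok j
  ... | inj₁ (wⱼ≡vⱼ , _) = λ e → anchor≢hop₁ i j (trans e wⱼ≡vⱼ)
  ... | inj₂ detour      = Detour.not-anchor detour i

  hop₁≢hop₂ : ∀ i j → i ≢ j → hop₁ i ≢ hop₂ j
  hop₁≢hop₂ i j i≢j = hop₁-not-others-second-hop (hop₂-ok j) (i≢j ∘ sym)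

  hop₂≢target : ∀ i j → hop₂ i ≢ target j
  hop₂≢target i j with hop₂-ok i
  ... | inj₁ (wᵢ≡vᵢ , _) = λ e → hop₁≢target i j (trans (sym wᵢ≡vᵢ) e)
  ... | inj₂ detour      = λ e → Detour.off-Q detour (subst (VQ Q) (sym e) (target-on-Q j))

  route′ : ∀ j → SecondHop j (hop₂ j) → Path n
  route′ j (inj₁ _) = a j ∷ hop₁ j ∷ target j ∷ []
  route′ j (inj₂ _) = a j ∷ hop₁ j ∷ hop₂ j ∷ target j ∷ []

  route : Fin m → Path n
  route j = route′ j (hop₂-ok j)

  anchor-in-host : ∀ j → Host (a j)
  anchor-in-host j = inj₂ (inj₂ (j , refl))

  hop₁-in-host : ∀ j → Host (hop₁ j)
  hop₁-in-host j = inj₁ (hop₁-off-Q j , FirstHop.∉W (hop₁-ok j) , proj₁ (proj₂ (hop₁-out-nbr j)))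

  target-in-host : ∀ j → Host (target j)
  target-in-host j = inj₂ (inj₁ (π ⟨$⟩ʳ j , refl))

  route′-ok : ∀ j h → IsPathIn D Host (route′ j h) × ini (route′ j h) ≡ a j ×
    ter (route′ j h) ≡ target j × plen (route′ j h) ≤ 3
  route′-ok j (inj₁ (_ , v→t)) =
    ( (anchor-in-host j ∷ hop₁-in-host j ∷ target-in-host j ∷ [])
    , (anchor≢hop₁ j j ∷ anchor≢target j j ∷ []) ∷ (hop₁≢target j j ∷ []) ∷ [] ∷ []
    , proj₁ (hop₁-out-nbr j) ∷ v→t ∷ [-])
    , refl , refl , s≤s (s≤s z≤n)
  route′-ok j (inj₂ detour) =
    ( (anchor-in-host j ∷ hop₁-in-host j ∷ inj₁ (Detour.off-Q detour , Detour.∉W detour , Detour.∉X detour)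
        ∷ target-in-host j ∷ [])
    , (anchor≢hop₁ j j ∷ Detour.not-anchor detour j ∷ anchor≢target j j ∷ [])
        ∷ (Detour.not-hop₁ detour j ∷ hop₁≢target j j ∷ [])
        ∷ (hop₂≢target j j ∷ []) ∷ [] ∷ []
    , proj₁ (hop₁-out-nbr j) ∷ Detour.from-hop₁ detour ∷ Detour.to-target detour ∷ [-])
    , refl , refl , ≤-refl

  route-ok : ∀ j → IsPathIn D Host (route j) × ini (route j) ≡ a j ×
    ter (route j) ≡ target j × plen (route j) ≤ 3
  route-ok j = route′-ok j (hop₂-ok j)

  data OnRoute (j : Fin m) (x : Fin n) : Set where
    is-anchor : x ≡ a j      → OnRoute j x
    is-hop₁   : x ≡ hop₁ j   → OnRoute j x
    is-hop₂   : x ≡ hop₂ j   → OnRoute j x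
    is-target : x ≡ target j → OnRoute j x

  on-route : ∀ j h {x} → x ∈P route′ j h → OnRoute j x
  on-route j (inj₁ _) (here e)                         = is-anchor e
  on-route j (inj₁ _) (there (here e))                 = is-hop₁ e
  on-route j (inj₁ _) (there (there (here e)))         = is-target e
  on-route j (inj₂ _) (here e)                         = is-anchor e
  on-route j (inj₂ _) (there (here e))                 = is-hop₁ e
  on-route j (inj₂ _) (there (there (here e)))         = is-hop₂ e
  on-route j (inj₂ _) (there (there (there (here e)))) = is-target e

  routes-apart : ∀ i j → i ≢ j → ∀ {x} → OnRoute i x → OnRoute j x → ⊥
  routes-apart i j i≢j (is-anchor refl) (is-anchor e) = i≢j (a-inj i j e)
  routes-apart i j i≢j (is-anchor refl) (is-hop₁ e)   = anchor≢hop₁ i j e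
  routes-apart i j i≢j (is-anchor refl) (is-hop₂ e)   = anchor≢hop₂ i j e
  routes-apart i j i≢j (is-anchor refl) (is-target e) = anchor≢target i j e
  routes-apart i j i≢j (is-hop₁ refl)   (is-anchor e) = anchor≢hop₁ j i (sym e)
  routes-apart i j i≢j (is-hop₁ refl)   (is-hop₁ e)   = i≢j (hop₁-injective i j e)
  routes-apart i j i≢j (is-hop₁ refl)   (is-hop₂ e)   = hop₁≢hop₂ i j i≢j e
  routes-apart i j i≢j (is-hop₁ refl)   (is-target e) = hop₁≢target i j e
  routes-apart i j i≢j (is-hop₂ refl)   (is-anchor e) = anchor≢hop₂ j i (sym e)
  routes-apart i j i≢j (is-hop₂ refl)   (is-hop₁ e)   = hop₁≢hop₂ j i (i≢j ∘ sym) (sym e)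
  routes-apart i j i≢j (is-hop₂ refl)   (is-hop₂ e)   = i≢j (hop₂-injective i j e)
  routes-apart i j i≢j (is-hop₂ refl)   (is-target e) = hop₂≢target i j e
  routes-apart i j i≢j (is-target refl) (is-anchor e) = anchor≢target j i (sym e)
  routes-apart i j i≢j (is-target refl) (is-hop₁ e)   = hop₁≢target j i (sym e)
  routes-apart i j i≢j (is-target refl) (is-hop₂ e)   = hop₂≢target j i (sym e)
  routes-apart i j i≢j (is-target refl) (is-target e) = i≢j (target-injective i j e)

  routes-disjoint : ∀ i j → i ≢ j → Disjoint (route i) (route j)
  routes-disjoint i j i≢j x x∈ᵢ x∈ⱼ =
    routes-apart i j i≢j (on-route i (hop₂-ok i) x∈ᵢ) (on-route j (hop₂-ok j) x∈ⱼ)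

lemma2p6 : ∀ {n} (k : ℕ) → 2 ≤ k → (D : Digraph n) → (X Y W U : Subset n) →
    (∀ v → v ∈ X → v ∉ Y) → (∀ v → v ∈ X → v ∉ W) → (∀ v → v ∈ Y → v ∉ W) →
    ∣ X ∣ ≡ k → ∣ Y ∣ ≡ k →
    NearlyInDominating D (λ v → v ∉ X × v ∉ Y) U → ∣ U ∣ ≡ 3 * k →
    (Q : Fin k → Path n) → IsPathCollection D k U Y Q →
    (∀ (Q′ : Fin k → Path n) → IsPathCollection D k U Y Q′ → totalVertices Q ≤ totalVertices Q′) →
    (m : ℕ) → (a : Fin m → Fin n) → Injective a → m ≤ k →
    (∀ i → a i ∉ W × ¬ Ini Q (a i)) →
    (∀ i → Σ (Subset n) λ B → ∣ B ∣ ≥ 7 * k + 3 * ∣ W ∣ + 7 * m ×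
       (∀ v → v ∈ B → Arc D (a i) v × v ∉ X × v ∉ Y × v ∉ U ×
          InDominator1 D (λ u → u ∈ U × ¬ Ini Q u) v)) →
    ∀ (s : Fin m → Fin n) → Injective s → (∀ i → Ini Q (s i) × s i ∉ W) →
    ShortAnchors D
      (λ v → (¬ VQ Q v × v ∉ W × v ∉ X) ⊎ (∃ λ i → s i ≡ v) ⊎ (∃ λ i → a i ≡ v))
      a s
lemma2p6 k _ D X Y W U _ _ _ _ _ U-dom _ Q Q-paths Q-min m a a-inj _ a-ok a-out s s-inj s-ok π =
  route , route-ok , routes-disjoint
  where open Anchoring k D X Y W U U-dom Q Q-paths Q-min m a a-inj a-ok a-out s s-inj s-ok π
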